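{- For every $n\in\mathbb{N}$, the ARS $\mathcal{A}_n$ (defined below) does not belong to $\mathrm{DC}_n$.
   Context: ARSs with two relations $(A,\to,\leadsto)$. Construction: $\mathcal{A}_0$ has elements $s_0,a_2,a_3,c,b_2,b_3,t_0$ and steps $s_0\to a_2$, $s_0\leadsto a_3$, $a_2\to c$, $a_2\leadsto c$, $a_3\to c$, $a_3\leadsto c$, $t_0\leadsto b_2$, $t_0\to b_3$, $b_2\to c$, $b_2\leadsto c$, $b_3\to c$, $b_3\leadsto c$. Given $\mathcal{A}_n$ with distinguished elements $s_n,t_n$, $\mathcal{A}_{n+1}$ is obtained by adding 14 fresh elements $x_1,\dots,x_7,y_1,\dots,y_7$ and the steps $x_1\leadsto x_2\leadsto x_4\leadsto x_5\leadsto x_7\leadsto s_n$, $x_1\to x_3\to x_4\to x_6\to x_7\to t_n$, $x_3\leadsto x_6\leadsto t_n$, $x_2\to x_5\to s_n$, $y_1\to y_2\to y_4\to y_5\to y_7\to s_n$, $y_1\leadsto y_3\leadsto y_4\leadsto y_6\leadsto y_7\leadsto t_n$, $y_3\to y_6\to t_n$, $y_2\leadsto y_5\leadsto s_n$; set $s_{n+1}=x_1$, $t_{n+1}=y_1$. For an ordinal $\alpha$, $(A,\to,\leadsto)\in\mathrm{DC}_\alpha$ if there are families $(\to_\gamma)_{\gamma<\alpha}$, $(\leadsto_\gamma)_{\gamma<\alpha}$ with unions $\to$ and $\leadsto$ respectively such that for every peak $a\to_\beta c$, $a\leadsto_\gamma b$ there is $d$ with $b \twoheadrightarrow_{<\gamma}\cdot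 \to^{\equiv}_{\beta}\cdot \twoheadrightarrow_{<\gamma\cup<\beta} d$ and $c \leadsto^*_{<\beta}\cdot \leadsto^{\equiv}_{\gamma}\cdot \leadsto^*_{<\gamma\cup<\beta} d$, where ${\to_{<\delta}}=\bigcup_{\epsilon<\delta}{\to_\epsilon}$, ${\to_{<\gamma\cup<\beta}}={\to_{<\gamma}}\cup{\to_{<\beta}}$ (likewise for $\leadsto$), $\twoheadrightarrow_X,\leadsto^*_X$ are reflexive transitive closures and $R^\equiv$ is $R$ union identity. (With $\alpha=0$ the label set is empty.) -}

module Defs where

open import Level using (0ℓ)
open import Data.Nat using (ℕ; zero; suc)
open import Data.Fin using (Fin; _<_)
open import Data.Product using (Σ; ∃; ∃-syntax; _×_; _,_)
open import Data.Sum using (_⊎_; inj₁; inj₂)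
open import Relation.Binary using (Rel)
open import Relation.Binary.PropositionalEquality using (_≡_)
open import Relation.Binary.Construct.Closure.ReflexiveTransitive using (Star)
open import Function.Bundles using (_⇔_)

record ARS₂ : Set₁ where
  field
    Carrier : Set
    _⟶_ : Rel Carrier 0ℓ
    _↝_ : Rel Carrier 0ℓ

_⨾_ : {A : Set} → Rel A 0ℓ → Rel A 0ℓ → Rel A 0ℓ
(R ⨾ S) x z = ∃[ y ] (R x y × S y z)

_≡∪ : {A : Set} → Rel A 0ℓ → Rel A 0ℓ
(R ≡∪) x y = x ≡ y ⊎ R x y

_∪_ : {A : Set} → Rel A 0ℓ → Rel A 0ℓ → Rel A 0ℓ
(R ∪ S) x y = R x y ⊎ S x y

below : {A : Set} {n : ℕ} → (Fin n → Rel A 0ℓ) → Fin n → Rel A 0ℓ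
below {n = n} R δ x y = ∃[ ε ] (ε < δ × R ε x y)

UnionIs : {A : Set} {n : ℕ} → (Fin n → Rel A 0ℓ) → Rel A 0ℓ → Set
UnionIs {A} R S = ∀ (x y : A) → (S x y ⇔ (∃[ γ ] R γ x y))

-- DC_α for a finite ordinal α = n (label set = {γ | γ < n} = Fin n)
DC : ℕ → ARS₂ → Set₁
DC n 𝒜 =
  Σ (Fin n → Rel Carrier 0ℓ) λ ⟶ₗ →
  Σ (Fin n → Rel Carrier 0ℓ) λ ↝ₗ →
    UnionIs ⟶ₗ _⟶_ × UnionIs ↝ₗ _↝_ ×
    (∀ (β γ : Fin n) (a b c : Carrier) → ⟶ₗ β a c → ↝ₗ γ a b →
      ∃[ d ]
        ( (Star (below ⟶ₗ γ) ⨾ ((⟶ₗ β ≡∪) ⨾ Star (below ⟶ₗ γ ∪ below ⟶ₗ β))) b d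
        × (Star (below ↝ₗ β) ⨾ ((↝ₗ γ ≡∪) ⨾ Star (below ↝ₗ γ ∪ below ↝ₗ β))) c d))
  where open ARS₂ 𝒜

data Base : Set where
  s₀ a₂ a₃ c b₂ b₃ t₀ : Base

data Arr₀ : Rel Base 0ℓ where
  s₀a₂ : Arr₀ s₀ a₂
  a₂c  : Arr₀ a₂ c
  a₃c  : Arr₀ a₃ c
  t₀b₃ : Arr₀ t₀ b₃
  b₂c  : Arr₀ b₂ c
  b₃c  : Arr₀ b₃ c

data Sq₀ : Rel Base 0ℓ where
  s₀a₃ : Sq₀ s₀ a₃
  a₂c  : Sq₀ a₂ c
  a₃c  : Sq₀ a₃ c
  t₀b₂ : Sq₀ t₀ b₂
  b₂c  : Sq₀ b₂ c
  b₃c  : Sq₀ b₃ c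

data New : Set where
  x₁ x₂ x₃ x₄ x₅ x₆ x₇ y₁ y₂ y₃ y₄ y₅ y₆ y₇ : New

-- → of 𝒜_{n+1}, given → of 𝒜_n and s_n, t_n  (old elements are inj₁, fresh are inj₂)
data ArrS {C : Set} (R : Rel C 0ℓ) (s t : C) : Rel (C ⊎ New) 0ℓ where
  old : ∀ {a b} → R a b → ArrS R s t (inj₁ a) (inj₁ b)
  x₁x₃ : ArrS R s t (inj₂ x₁) (inj₂ x₃)
  x₃x₄ : ArrS R s t (inj₂ x₃) (inj₂ x₄)
  x₄x₆ : ArrS R s t (inj₂ x₄) (inj₂ x₆)
  x₆x₇ : ArrS R s t (inj₂ x₆) (inj₂ x₇)
  x₇t  : ArrS R s t (inj₂ x₇) (inj₁ t)
  x₂x₅ : ArrS R s t (inj₂ x₂) (inj₂ x₅)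
  x₅s  : ArrS R s t (inj₂ x₅) (inj₁ s)
  y₁y₂ : ArrS R s t (inj₂ y₁) (inj₂ y₂)
  y₂y₄ : ArrS R s t (inj₂ y₂) (inj₂ y₄)
  y₄y₅ : ArrS R s t (inj₂ y₄) (inj₂ y₅)
  y₅y₇ : ArrS R s t (inj₂ y₅) (inj₂ y₇)
  y₇s  : ArrS R s t (inj₂ y₇) (inj₁ s)
  y₃y₆ : ArrS R s t (inj₂ y₃) (inj₂ y₆)
  y₆t  : ArrS R s t (inj₂ y₆) (inj₁ t)

data SqS {C : Set} (R : Rel C 0ℓ) (s t : C) : Rel (C ⊎ New) 0ℓ where
  old : ∀ {a b} → R a b → SqS R s t (inj₁ a) (inj₁ b)
  x₁x₂ : SqS R s t (inj₂ x₁) (inj₂ x₂)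
  x₂x₄ : SqS R s t (inj₂ x₂) (inj₂ x₄)
  x₄x₅ : SqS R s t (inj₂ x₄) (inj₂ x₅)
  x₅x₇ : SqS R s t (inj₂ x₅) (inj₂ x₇)
  x₇s  : SqS R s t (inj₂ x₇) (inj₁ s)
  x₃x₆ : SqS R s t (inj₂ x₃) (inj₂ x₆)
  x₆t  : SqS R s t (inj₂ x₆) (inj₁ t)
  y₁y₃ : SqS R s t (inj₂ y₁) (inj₂ y₃)
  y₃y₄ : SqS R s t (inj₂ y₃) (inj₂ y₄)
  y₄y₆ : SqS R s t (inj₂ y₄) (inj₂ y₆)
  y₆y₇ : SqS R s t (inj₂ y₆) (inj₂ y₇)
  y₇t  : SqS R s t (inj₂ y₇) (inj₁ t)
  y₂y₅ : SqS R s t (inj₂ y₂) (inj₂ y₅)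
  y₅s  : SqS R s t (inj₂ y₅) (inj₁ s)

El : ℕ → Set
El zero = Base
El (suc n) = El n ⊎ New

sₙ : (n : ℕ) → El n
sₙ zero = s₀
sₙ (suc n) = inj₂ x₁

tₙ : (n : ℕ) → El n
tₙ zero = t₀
tₙ (suc n) = inj₂ y₁

Arr : (n : ℕ) → Rel (El n) 0ℓ
Arr zero = Arr₀
Arr (suc n) = ArrS (Arr n) (sₙ n) (tₙ n)

Sq : (n : ℕ) → Rel (El n) 0ℓ
Sq zero = Sq₀
Sq (suc n) = SqS (Sq n) (sₙ n) (tₙ n)

𝒜 : ℕ → ARS₂
𝒜 n = record { Carrier = El n ; _⟶_ = Arr n ; _↝_ = Sq n }

-- Suppose 𝒜 (n+1) ∈ DC (n+1), and call u, v joinable at height m when an →-path from u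
-- and a ↝-path from v meet, each using labels < m except for at most one step. Resolving
-- the peaks x₁ → x₃, x₁ ↝ x₂ and y₁ → y₂, y₁ ↝ y₃ and following the side branches
-- x₂ → x₅ → sₙ, x₃ ↝ x₆ ↝ tₙ (resp. y₃ → y₆ → tₙ, y₂ ↝ y₅ ↝ sₙ) shows that sₙ and tₙ are
-- joinable both ways at height n. Conversely, if x₁ = s (k+1) and y₁ = t (k+1) are joinable
-- both ways at height m, the meeting points lie off the gadget, so the →-path and the
-- ↝-path out of x₁ traverse x₁ x₃ x₄ x₆ x₇ and x₁ x₂ x₄ x₅ x₇ with at most one exceptional
-- step each: at one of x₁, x₄, x₇ both outgoing steps have labels < m. Resolving that peak
-- as above makes s k and t k joinable at height m - 1, and the y-gadget gives the other
-- direction. At height 0 nothing is joinable, and in 𝒜 0 the only steps s₀ → a₂, t₀ ↝ b₂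
-- keep s₀ and t₀ apart, so the descent is impossible. (DC 0 is empty, since s₀ → a₂
-- needs a label.)

module Submission where

open import Defs
open import Data.Nat using (ℕ)
open import Relation.Nullary using (¬_)

open import Level using (0ℓ)
open import Data.Nat using (zero; suc; _≤_; _<_; z≤n; s≤s; s≤s⁻¹)
open import Data.Nat.Properties using (<-≤-trans; ≤-refl)
open import Data.Fin using (Fin; toℕ)
open import Data.Fin.Properties using (toℕ<n)
open import Data.Bool using (Bool; true; false; T; not)
open import Data.Unit using (⊤; tt)
open import Data.Empty using (⊥; ⊥-elim)
open import Data.Product using (∃-syntax; _×_; _,_; proj₁; proj₂)
open import Data.Sum using (_⊎_; inj₁; inj₂; [_,_])
open import Data.Sum.Properties using (inj₁-injective)
open import Function using (_∘_)
open import Relation.Binary using (Rel)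
open import Relation.Binary.PropositionalEquality using (_≡_; _≢_; refl; sym; trans; cong; subst)
open import Relation.Binary.Construct.Closure.ReflexiveTransitive using (Star; ε; _◅_)
open import Function.Bundles using (Equivalence)

module _ {X : Set} {L : ℕ} where

  Low : (Fin L → Rel X 0ℓ) → ℕ → Rel X 0ℓ
  Low R m x y = ∃[ ℓ ] (R ℓ x y × toℕ ℓ < m)

  Forced : (Fin L → Rel X 0ℓ) → Rel X 0ℓ
  Forced R x x′ = ∀ {ℓ y} → R ℓ x y → y ≡ x′

  -- Labels are < m, except for at most one step, which is still allowed iff the flag is true.
  data Path (R : Fin L → Rel X 0ℓ) (m : ℕ) : Bool → X → X → Set where
    []   : ∀ {e x} → Path R m e x x
    _∷_  : ∀ {e x y z} → Low R m x y → Path R m e y z → Path R m e x z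
    _!∷_ : ∀ {ℓ x y z} → R ℓ x y → Path R m false y z → Path R m true x z

  Path-zero : ∀ {R x x′ d} → Path R 0 true x d → Forced R x x′ → x ≡ d ⊎ x′ ≡ d
  Path-zero [] _ = inj₁ refl
  Path-zero ((_ , _ , ()) ∷ _) _
  Path-zero (r !∷ []) forced = inj₂ (sym (forced r))
  Path-zero (_ !∷ ((_ , _ , ()) ∷ _)) _

module _ {X : Set} {L : ℕ} {R : Fin L → Rel X 0ℓ} {m : ℕ} where

  relax : ∀ {e x y} → Path R m e x y → Path R m true x y
  relax [] = []
  relax (l ∷ p) = l ∷ relax p
  relax (r !∷ p) = r !∷ p

  Path-preserves : (Q : X → Set) → (∀ {ℓ x y} → R ℓ x y → Q x → Q y) →
                   ∀ {e x y} → Path R m e x y → Q x → Q y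
  Path-preserves Q step [] q = q
  Path-preserves Q step ((_ , r , _) ∷ p) q = Path-preserves Q step p (step r q)
  Path-preserves Q step (r !∷ p) q = Path-preserves Q step p (step r q)

  forced-step : ∀ {e x x′ d} → Path R m e x d → x ≢ d → Forced R x x′ →
                (Low R m x x′ × Path R m e x′ d) ⊎ Path R m false x′ d
  forced-step [] x≢d _ = ⊥-elim (x≢d refl)
  forced-step (l@(_ , r , _) ∷ p) _ forced with forced r
  ... | refl = inj₁ (l , p)
  forced-step (r !∷ p) _ forced with forced r
  ... | refl = inj₂ p

  forced-step-low : ∀ {x x′ d} → Path R m false x d → x ≢ d → Forced R x x′ →
                    Low R m x x′ × Path R m false x′ d
  forced-step-low [] x≢d _ = ⊥-elim (x≢d refl)
  forced-step-low (l@(_ , r , _) ∷ p) _ forced with forced r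
  ... | refl = l , p

  skip-forced : ∀ {e x x′ d} → Path R m e x d → x ≢ d → Forced R x x′ → Path R m true x′ d
  skip-forced p x≢d forced = [ relax ∘ proj₂ , relax ] (forced-step p x≢d forced)

  below-star : ∀ {δ e x y z} → Star (below R δ) x y → toℕ δ ≤ m → Path R m e y z → Path R m e x z
  below-star ε _ p = p
  below-star ((ℓ , ℓ<δ , r) ◅ s) δ≤m p = (ℓ , r , <-≤-trans ℓ<δ δ≤m) ∷ below-star s δ≤m p

  below∪-star : ∀ {δ δ′ e x y} → Star (below R δ ∪ below R δ′) x y →
                toℕ δ ≤ m → toℕ δ′ ≤ m → Path R m e x y
  below∪-star ε _ _ = []
  below∪-star (inj₁ (ℓ , ℓ<δ , r) ◅ s) δ≤m δ′≤m =
    (ℓ , r , <-≤-trans ℓ<δ δ≤m) ∷ below∪-star s δ≤m δ′≤m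
  below∪-star (inj₂ (ℓ , ℓ<δ′ , r) ◅ s) δ≤m δ′≤m =
    (ℓ , r , <-≤-trans ℓ<δ′ δ′≤m) ∷ below∪-star s δ≤m δ′≤m

  join-path : ∀ {δ ℓ δ₁ δ₂ x y} →
              (Star (below R δ) ⨾ ((R ℓ ≡∪) ⨾ Star (below R δ₁ ∪ below R δ₂))) x y →
              toℕ δ ≤ m → toℕ δ₁ ≤ m → toℕ δ₂ ≤ m → Path R m true x y
  join-path (_ , s , _ , inj₁ refl , s′) δ≤m δ₁≤m δ₂≤m =
    below-star s δ≤m (below∪-star s′ δ₁≤m δ₂≤m)
  join-path (_ , s , _ , inj₂ r , s′) δ≤m δ₁≤m δ₂≤m =
    below-star s δ≤m (r !∷ below∪-star s′ δ₁≤m δ₂≤m)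

TwoOfThree : Set → Set → Set → Set
TwoOfThree A B C = (A × B) ⊎ (A × C) ⊎ (B × C)

TwoOfThree-common : ∀ {A₁ A₂ A₃ B₁ B₂ B₃ : Set} → TwoOfThree A₁ A₂ A₃ → TwoOfThree B₁ B₂ B₃ →
                    (A₁ × B₁) ⊎ (A₂ × B₂) ⊎ (A₃ × B₃)
TwoOfThree-common (inj₁ (u₁ , _)) (inj₁ (v₁ , _)) = inj₁ (u₁ , v₁)
TwoOfThree-common (inj₁ (u₁ , _)) (inj₂ (inj₁ (v₁ , _))) = inj₁ (u₁ , v₁)
TwoOfThree-common (inj₁ (_ , u₂)) (inj₂ (inj₂ (v₂ , _))) = inj₂ (inj₁ (u₂ , v₂))
TwoOfThree-common (inj₂ (inj₁ (u₁ , _))) (inj₁ (v₁ , _)) = inj₁ (u₁ , v₁)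
TwoOfThree-common (inj₂ (inj₁ (u₁ , _))) (inj₂ (inj₁ (v₁ , _))) = inj₁ (u₁ , v₁)
TwoOfThree-common (inj₂ (inj₁ (_ , u₃))) (inj₂ (inj₂ (_ , v₃))) = inj₂ (inj₂ (u₃ , v₃))
TwoOfThree-common (inj₂ (inj₂ (u₂ , _))) (inj₁ (_ , v₂)) = inj₂ (inj₁ (u₂ , v₂))
TwoOfThree-common (inj₂ (inj₂ (_ , u₃))) (inj₂ (inj₁ (_ , v₃))) = inj₂ (inj₂ (u₃ , v₃))
TwoOfThree-common (inj₂ (inj₂ (u₂ , _))) (inj₂ (inj₂ (v₂ , _))) = inj₂ (inj₁ (u₂ , v₂))

module _ {X : Set} {L : ℕ} {R : Fin L → Rel X 0ℓ} {m : ℕ} where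

  two-low-in-forced-chain : ∀ {w₁ w₂ w₃ w₄ w₅ w₆ d} → Path R m true w₁ d →
    Forced R w₁ w₂ → Forced R w₂ w₃ → Forced R w₃ w₄ → Forced R w₄ w₅ → Forced R w₅ w₆ →
    w₁ ≢ d → w₂ ≢ d → w₃ ≢ d → w₄ ≢ d → w₅ ≢ d →
    TwoOfThree (Low R m w₁ w₂) (Low R m w₃ w₄) (Low R m w₅ w₆)
  two-low-in-forced-chain p f₁ f₂ f₃ f₄ f₅ n₁ n₂ n₃ n₄ n₅ with forced-step p n₁ f₁
  ... | inj₂ p₂ =
    let _ , p₃ = forced-step-low p₂ n₂ f₂
        l₃ , p₄ = forced-step-low p₃ n₃ f₃
        _ , p₅ = forced-step-low p₄ n₄ f₄
    in inj₂ (inj₂ (l₃ , proj₁ (forced-step-low p₅ n₅ f₅)))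
  ... | inj₁ (l₁ , p₂) with forced-step p₂ n₂ f₂
  ...   | inj₂ p₃ = inj₁ (l₁ , proj₁ (forced-step-low p₃ n₃ f₃))
  ...   | inj₁ (_ , p₃) with forced-step p₃ n₃ f₃
  ...     | inj₁ (l₃ , _) = inj₁ (l₁ , l₃)
  ...     | inj₂ p₄ =
    let _ , p₅ = forced-step-low p₄ n₄ f₄
    in inj₂ (inj₁ (l₁ , proj₁ (forced-step-low p₅ n₅ f₅)))

arrNext : {C : Set} → C → C → New → C ⊎ New
arrNext s t x₁ = inj₂ x₃
arrNext s t x₂ = inj₂ x₅
arrNext s t x₃ = inj₂ x₄
arrNext s t x₄ = inj₂ x₆
arrNext s t x₅ = inj₁ s
arrNext s t x₆ = inj₂ x₇
arrNext s t x₇ = inj₁ t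
arrNext s t y₁ = inj₂ y₂
arrNext s t y₂ = inj₂ y₄
arrNext s t y₃ = inj₂ y₆
arrNext s t y₄ = inj₂ y₅
arrNext s t y₅ = inj₂ y₇
arrNext s t y₆ = inj₁ t
arrNext s t y₇ = inj₁ s

sqNext : {C : Set} → C → C → New → C ⊎ New
sqNext s t x₁ = inj₂ x₂
sqNext s t x₂ = inj₂ x₄
sqNext s t x₃ = inj₂ x₆
sqNext s t x₄ = inj₂ x₅
sqNext s t x₅ = inj₂ x₇
sqNext s t x₆ = inj₁ t
sqNext s t x₇ = inj₁ s
sqNext s t y₁ = inj₂ y₃
sqNext s t y₂ = inj₂ y₅
sqNext s t y₃ = inj₂ y₄
sqNext s t y₄ = inj₂ y₆
sqNext s t y₅ = inj₁ s
sqNext s t y₆ = inj₂ y₇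
sqNext s t y₇ = inj₁ t

ArrS-next : ∀ {C R s t n v} → ArrS {C} R s t (inj₂ n) v → v ≡ arrNext s t n
ArrS-next x₁x₃ = refl
ArrS-next x₃x₄ = refl
ArrS-next x₄x₆ = refl
ArrS-next x₆x₇ = refl
ArrS-next x₇t = refl
ArrS-next x₂x₅ = refl
ArrS-next x₅s = refl
ArrS-next y₁y₂ = refl
ArrS-next y₂y₄ = refl
ArrS-next y₄y₅ = refl
ArrS-next y₅y₇ = refl
ArrS-next y₇s = refl
ArrS-next y₃y₆ = refl
ArrS-next y₆t = refl

SqS-next : ∀ {C R s t n v} → SqS {C} R s t (inj₂ n) v → v ≡ sqNext s t n
SqS-next x₁x₂ = refl
SqS-next x₂x₄ = refl
SqS-next x₄x₅ = refl
SqS-next x₅x₇ = refl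
SqS-next x₇s = refl
SqS-next x₃x₆ = refl
SqS-next x₆t = refl
SqS-next y₁y₃ = refl
SqS-next y₃y₄ = refl
SqS-next y₄y₆ = refl
SqS-next y₆y₇ = refl
SqS-next y₇t = refl
SqS-next y₂y₅ = refl
SqS-next y₅s = refl

InRegion : {C : Set} → (New → Bool) → C ⊎ New → Set
InRegion P (inj₁ _) = ⊤
InRegion P (inj₂ n) = T (P n)

xGadget : New → Bool
xGadget x₁ = true
xGadget x₂ = true
xGadget x₃ = true
xGadget x₄ = true
xGadget x₅ = true
xGadget x₆ = true
xGadget x₇ = true
xGadget _ = false

yGadget : New → Bool
yGadget = not ∘ xGadget

arrLane : New → Bool
arrLane x₂ = true
arrLane x₅ = true
arrLane y₃ = true
arrLane y₆ = true
arrLane _ = false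

sqLane : New → Bool
sqLane x₃ = true
sqLane x₆ = true
sqLane y₂ = true
sqLane y₅ = true
sqLane _ = false

module _ {C : Set} {R : Rel C 0ℓ} {s t : C} {u v : C ⊎ New} where

  xGadget-ArrS : ArrS R s t u v → InRegion xGadget u → InRegion xGadget v
  xGadget-ArrS = λ
    { (old _) _ → tt ; x₁x₃ _ → tt ; x₃x₄ _ → tt ; x₄x₆ _ → tt ; x₆x₇ _ → tt ; x₇t _ → tt
    ; x₂x₅ _ → tt ; x₅s _ → tt ; y₁y₂ () ; y₂y₄ () ; y₄y₅ () ; y₅y₇ () ; y₇s () ; y₃y₆ () ; y₆t () }

  yGadget-ArrS : ArrS R s t u v → InRegion yGadget u → InRegion yGadget v
  yGadget-ArrS = λ
    { (old _) _ → tt ; x₁x₃ () ; x₃x₄ () ; x₄x₆ () ; x₆x₇ () ; x₇t () ; x₂x₅ () ; x₅s ()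
    ; y₁y₂ _ → tt ; y₂y₄ _ → tt ; y₄y₅ _ → tt ; y₅y₇ _ → tt ; y₇s _ → tt ; y₃y₆ _ → tt ; y₆t _ → tt }

  arrLane-ArrS : ArrS R s t u v → InRegion arrLane u → InRegion arrLane v
  arrLane-ArrS = λ
    { (old _) _ → tt ; x₁x₃ () ; x₃x₄ () ; x₄x₆ () ; x₆x₇ () ; x₇t () ; x₂x₅ _ → tt ; x₅s _ → tt
    ; y₁y₂ () ; y₂y₄ () ; y₄y₅ () ; y₅y₇ () ; y₇s () ; y₃y₆ _ → tt ; y₆t _ → tt }

  xGadget-SqS : SqS R s t u v → InRegion xGadget u → InRegion xGadget v
  xGadget-SqS = λ
    { (old _) _ → tt ; x₁x₂ _ → tt ; x₂x₄ _ → tt ; x₄x₅ _ → tt ; x₅x₇ _ → tt ; x₇s _ → tt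
    ; x₃x₆ _ → tt ; x₆t _ → tt ; y₁y₃ () ; y₃y₄ () ; y₄y₆ () ; y₆y₇ () ; y₇t () ; y₂y₅ () ; y₅s () }

  yGadget-SqS : SqS R s t u v → InRegion yGadget u → InRegion yGadget v
  yGadget-SqS = λ
    { (old _) _ → tt ; x₁x₂ () ; x₂x₄ () ; x₄x₅ () ; x₅x₇ () ; x₇s () ; x₃x₆ () ; x₆t ()
    ; y₁y₃ _ → tt ; y₃y₄ _ → tt ; y₄y₆ _ → tt ; y₆y₇ _ → tt ; y₇t _ → tt ; y₂y₅ _ → tt ; y₅s _ → tt }

  sqLane-SqS : SqS R s t u v → InRegion sqLane u → InRegion sqLane v
  sqLane-SqS = λ
    { (old _) _ → tt ; x₁x₂ () ; x₂x₄ () ; x₄x₅ () ; x₅x₇ () ; x₇s () ; x₃x₆ _ → tt ; x₆t _ → tt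
    ; y₁y₃ () ; y₃y₄ () ; y₄y₆ () ; y₆y₇ () ; y₇t () ; y₂y₅ _ → tt ; y₅s _ → tt }

module Decomposition {N : ℕ} (dc : DC N (𝒜 N)) where

  ⟶ₗ : Fin N → Rel (El N) 0ℓ
  ⟶ₗ = proj₁ dc

  ↝ₗ : Fin N → Rel (El N) 0ℓ
  ↝ₗ = proj₁ (proj₂ dc)

  ⟶-union : UnionIs ⟶ₗ (Arr N)
  ⟶-union = proj₁ (proj₂ (proj₂ dc))

  ↝-union : UnionIs ↝ₗ (Sq N)
  ↝-union = proj₁ (proj₂ (proj₂ (proj₂ dc)))

  unlabel-⟶ : ∀ {ℓ x y} → ⟶ₗ ℓ x y → Arr N x y
  unlabel-⟶ r = Equivalence.from (⟶-union _ _) (_ , r)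

  unlabel-↝ : ∀ {ℓ x y} → ↝ₗ ℓ x y → Sq N x y
  unlabel-↝ r = Equivalence.from (↝-union _ _) (_ , r)

  label-⟶ : ∀ {x y} → Arr N x y → Low ⟶ₗ N x y
  label-⟶ r with Equivalence.to (⟶-union _ _) r
  ... | ℓ , r′ = ℓ , r′ , toℕ<n ℓ

  label-↝ : ∀ {x y} → Sq N x y → Low ↝ₗ N x y
  label-↝ r with Equivalence.to (↝-union _ _) r
  ... | ℓ , r′ = ℓ , r′ , toℕ<n ℓ

  Joinable : ℕ → Rel (El N) 0ℓ
  Joinable m u v = ∃[ d ] (Path ⟶ₗ m true u d × Path ↝ₗ m true v d)

  peak-joinable : ∀ {m a b c} → Low ⟶ₗ (suc m) a c → Low ↝ₗ (suc m) a b → Joinable m b c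
  peak-joinable {m} (β , a⟶c , β<) (γ , a↝b , γ<)
    with proj₂ (proj₂ (proj₂ (proj₂ dc))) β γ _ _ _ a⟶c a↝b
  ... | d , b⟶d , c↝d = d , join-path b⟶d γ≤ γ≤ β≤ , join-path c↝d β≤ γ≤ β≤
    where
      β≤ : toℕ β ≤ m
      β≤ = s≤s⁻¹ β<
      γ≤ : toℕ γ ≤ m
      γ≤ = s≤s⁻¹ γ<

  record Embedding (k : ℕ) : Set where
    field
      ι : El k → El N
      ι-injective : ∀ {a b} → ι a ≡ ι b → a ≡ b
      ⟶-from-image : ∀ {a z} → Arr N (ι a) z → ∃[ b ] (z ≡ ι b × Arr k a b)
      ↝-from-image : ∀ {a z} → Sq N (ι a) z → ∃[ b ] (z ≡ ι b × Sq k a b)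

  id-embedding : Embedding N
  id-embedding = record
    { ι = λ a → a ; ι-injective = λ eq → eq
    ; ⟶-from-image = λ r → _ , refl , r ; ↝-from-image = λ r → _ , refl , r }

  restrict : ∀ {k} → Embedding (suc k) → Embedding k
  restrict {k} e = record
    { ι = ι ∘ inj₁ ; ι-injective = inj₁-injective ∘ ι-injective
    ; ⟶-from-image = ⟶-from-old ; ↝-from-image = ↝-from-old }
    where
      open Embedding e
      ⟶-from-old : ∀ {a z} → Arr N (ι (inj₁ a)) z → ∃[ b ] (z ≡ ι (inj₁ b) × Arr k a b)
      ⟶-from-old r with ⟶-from-image r
      ... | _ , eq , old r′ = _ , eq , r′
      ↝-from-old : ∀ {a z} → Sq N (ι (inj₁ a)) z → ∃[ b ] (z ≡ ι (inj₁ b) × Sq k a b)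
      ↝-from-old r with ↝-from-image r
      ... | _ , eq , old r′ = _ , eq , r′

  TwoWayJoinable : (k : ℕ) → Embedding k → ℕ → Set
  TwoWayJoinable k e m = Joinable m (ι (sₙ k)) (ι (tₙ k)) × Joinable m (ι (tₙ k)) (ι (sₙ k))
    where open Embedding e

  no-join-at-base : (e : Embedding 0) → ¬ Joinable 0 (Embedding.ι e s₀) (Embedding.ι e t₀)
  no-join-at-base e (d , s₀⟶d , t₀↝d) = apart (Path-zero s₀⟶d s₀-forced) (Path-zero t₀↝d t₀-forced)
    where
      open Embedding e
      s₀-forced : Forced ⟶ₗ (ι s₀) (ι a₂)
      s₀-forced r with ⟶-from-image (unlabel-⟶ r)
      ... | _ , refl , s₀a₂ = refl
      t₀-forced : Forced ↝ₗ (ι t₀) (ι b₂)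
      t₀-forced r with ↝-from-image (unlabel-↝ r)
      ... | _ , refl , t₀b₂ = refl
      meet : ∀ {u v} → ι u ≡ d → ι v ≡ d → u ≡ v
      meet eu ev = ι-injective (trans eu (sym ev))
      apart : ι s₀ ≡ d ⊎ ι a₂ ≡ d → ι t₀ ≡ d ⊎ ι b₂ ≡ d → ⊥
      apart (inj₁ eu) (inj₁ ev) with () ← meet eu ev
      apart (inj₁ eu) (inj₂ ev) with () ← meet eu ev
      apart (inj₂ eu) (inj₁ ev) with () ← meet eu ev
      apart (inj₂ eu) (inj₂ ev) with () ← meet eu ev

  module Stage (k : ℕ) (e : Embedding (suc k)) where
    open Embedding e

    s t : El k
    s = sₙ k
    t = tₙ k

    forced-⟶ : ∀ n → Forced ⟶ₗ (ι (inj₂ n)) (ι (arrNext s t n))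
    forced-⟶ n r with ⟶-from-image (unlabel-⟶ r)
    ... | _ , refl , n⟶v = cong ι (ArrS-next n⟶v)

    forced-↝ : ∀ n → Forced ↝ₗ (ι (inj₂ n)) (ι (sqNext s t n))
    forced-↝ n r with ↝-from-image (unlabel-↝ r)
    ... | _ , refl , n↝v = cong ι (SqS-next n↝v)

    In : (New → Bool) → El N → Set
    In P z = ∃[ u ] (InRegion P u × z ≡ ι u)

    In-fresh : ∀ {P d} n → In P d → ι (inj₂ n) ≡ d → T (P n)
    In-fresh {P} n (u , u∈P , refl) eq = subst (InRegion P) (sym (ι-injective eq)) u∈P

    In-along-⟶ : ∀ P → (∀ {u v} → Arr (suc k) u v → InRegion P u → InRegion P v) →
                 ∀ {m f u d} → Path ⟶ₗ m f (ι u) d → InRegion P u → In P d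
    In-along-⟶ P closed p u∈P = Path-preserves (In P) step p (_ , u∈P , refl)
      where
        step : ∀ {ℓ x y} → ⟶ₗ ℓ x y → In P x → In P y
        step r (u , u∈P , refl) with ⟶-from-image (unlabel-⟶ r)
        ... | v , refl , u⟶v = v , closed u⟶v u∈P , refl

    In-along-↝ : ∀ P → (∀ {u v} → Sq (suc k) u v → InRegion P u → InRegion P v) →
                 ∀ {m f u d} → Path ↝ₗ m f (ι u) d → InRegion P u → In P d
    In-along-↝ P closed p u∈P = Path-preserves (In P) step p (_ , u∈P , refl)
      where
        step : ∀ {ℓ x y} → ↝ₗ ℓ x y → In P x → In P y
        step r (u , u∈P , refl) with ↝-from-image (unlabel-↝ r)
        ... | v , refl , u↝v = v , closed u↝v u∈P , refl

    lane-step : ∀ {m} a b {_ : T (arrLane a)} {_ : T (sqLane b)} →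
                ¬ T (sqLane a) → ¬ T (arrLane b) → Joinable m (ι (inj₂ a)) (ι (inj₂ b)) →
                Joinable m (ι (arrNext s t a)) (ι (sqNext s t b))
    lane-step {m} a b {a∈} {b∈} a∉ b∉ (d , a⟶d , b↝d) =
      d , skip-forced a⟶d (a∉ ∘ In-fresh a d∈sqLane) (forced-⟶ a)
        , skip-forced b↝d (b∉ ∘ In-fresh b d∈arrLane) (forced-↝ b)
      where
        d∈arrLane : In arrLane d
        d∈arrLane = In-along-⟶ arrLane arrLane-ArrS a⟶d a∈
        d∈sqLane : In sqLane d
        d∈sqLane = In-along-↝ sqLane sqLane-SqS b↝d b∈

    LowPeak : ℕ → New → Set
    LowPeak m n = Low ⟶ₗ m (ι (inj₂ n)) (ι (arrNext s t n)) × Low ↝ₗ m (ι (inj₂ n)) (ι (sqNext s t n))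

    LowPeakAmong : ℕ → New → New → New → Set
    LowPeakAmong m n₁ n₂ n₃ = LowPeak m n₁ ⊎ LowPeak m n₂ ⊎ LowPeak m n₃

    descend-x : ∀ {m} → LowPeakAmong (suc m) x₁ x₄ x₇ → Joinable m (ι (inj₁ s)) (ι (inj₁ t))
    descend-x (inj₁ (r , r′)) =
      lane-step x₅ x₆ (λ ()) (λ ()) (lane-step x₂ x₃ (λ ()) (λ ()) (peak-joinable r r′))
    descend-x (inj₂ (inj₁ (r , r′))) = lane-step x₅ x₆ (λ ()) (λ ()) (peak-joinable r r′)
    descend-x (inj₂ (inj₂ (r , r′))) = peak-joinable r r′

    descend-y : ∀ {m} → LowPeakAmong (suc m) y₁ y₄ y₇ → Joinable m (ι (inj₁ t)) (ι (inj₁ s))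
    descend-y (inj₁ (r , r′)) =
      lane-step y₆ y₅ (λ ()) (λ ()) (lane-step y₃ y₂ (λ ()) (λ ()) (peak-joinable r r′))
    descend-y (inj₂ (inj₁ (r , r′))) = lane-step y₆ y₅ (λ ()) (λ ()) (peak-joinable r r′)
    descend-y (inj₂ (inj₂ (r , r′))) = peak-joinable r r′

    low-peaks : ∀ {m} → TwoWayJoinable (suc k) e m →
                LowPeakAmong m x₁ x₄ x₇ × LowPeakAmong m y₁ y₄ y₇
    low-peaks ((d , x⟶d , y↝d) , (d′ , y⟶d′ , x↝d′)) =
        TwoOfThree-common
          (two-low-in-forced-chain x⟶d
            (forced-⟶ x₁) (forced-⟶ x₃) (forced-⟶ x₄) (forced-⟶ x₆) (forced-⟶ x₇)
            (In-fresh x₁ d∈y) (In-fresh x₃ d∈y) (In-fresh x₄ d∈y) (In-fresh x₆ d∈y) (In-fresh x₇ d∈y))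
          (two-low-in-forced-chain x↝d′
            (forced-↝ x₁) (forced-↝ x₂) (forced-↝ x₄) (forced-↝ x₅) (forced-↝ x₇)
            (In-fresh x₁ d′∈y) (In-fresh x₂ d′∈y) (In-fresh x₄ d′∈y) (In-fresh x₅ d′∈y) (In-fresh x₇ d′∈y))
      , TwoOfThree-common
          (two-low-in-forced-chain y⟶d′
            (forced-⟶ y₁) (forced-⟶ y₂) (forced-⟶ y₄) (forced-⟶ y₅) (forced-⟶ y₇)
            (In-fresh y₁ d′∈x) (In-fresh y₂ d′∈x) (In-fresh y₄ d′∈x) (In-fresh y₅ d′∈x) (In-fresh y₇ d′∈x))
          (two-low-in-forced-chain y↝d
            (forced-↝ y₁) (forced-↝ y₃) (forced-↝ y₄) (forced-↝ y₆) (forced-↝ y₇)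
            (In-fresh y₁ d∈x) (In-fresh y₃ d∈x) (In-fresh y₄ d∈x) (In-fresh y₆ d∈x) (In-fresh y₇ d∈x))
      where
        d∈y : In yGadget d
        d∈y = In-along-↝ yGadget yGadget-SqS y↝d tt
        d∈x : In xGadget d
        d∈x = In-along-⟶ xGadget xGadget-ArrS x⟶d tt
        d′∈y : In yGadget d′
        d′∈y = In-along-⟶ yGadget yGadget-ArrS y⟶d′ tt
        d′∈x : In xGadget d′
        d′∈x = In-along-↝ xGadget xGadget-SqS x↝d′ tt

    no-two-way-join-at-zero : ¬ TwoWayJoinable (suc k) e 0
    no-two-way-join-at-zero j with proj₁ (low-peaks j)
    ... | inj₁ ((_ , _ , ()) , _)
    ... | inj₂ (inj₁ ((_ , _ , ()) , _))
    ... | inj₂ (inj₂ ((_ , _ , ()) , _))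

    descend : ∀ {m} → TwoWayJoinable (suc k) e (suc m) → TwoWayJoinable k (restrict e) m
    descend j = let px , py = low-peaks j in descend-x px , descend-y py

  no-two-way-join : ∀ k (e : Embedding k) m → m ≤ k → ¬ TwoWayJoinable k e m
  no-two-way-join zero e zero z≤n (j , _) = no-join-at-base e j
  no-two-way-join (suc k) e zero _ = Stage.no-two-way-join-at-zero k e
  no-two-way-join (suc k) e (suc m) (s≤s m≤k) =
    no-two-way-join k (restrict e) m m≤k ∘ Stage.descend k e

lemma5p7 : (n : ℕ) → ¬ DC n (𝒜 n)
lemma5p7 zero (_ , _ , ⟶-union , _) with Equivalence.to (⟶-union s₀ a₂) s₀a₂
... | () , _
lemma5p7 (suc n) dc =
  no-two-way-join n (restrict id-embedding) n ≤-refl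
    ( descend-x (inj₁ (label-⟶ x₁x₃ , label-↝ x₁x₂))
    , descend-y (inj₁ (label-⟶ y₁y₂ , label-↝ y₁y₃)))
  where
    open Decomposition dc
    open Stage n id-embedding
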